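{- Let $k \geq 1$ and $2k+2 \leq n \leq 3k+1$. Then the power of a cycle $C_n^k$ has biclique-chromatic number $2$.
   Context: For $k \geq 1$, the power of a cycle $C_n^k$ is the simple graph with vertex set $\{v_0,\dots,v_{n-1}\}$ in which $v_i v_j$ ($i\neq j$) is an edge if and only if $\min\{(j-i) \bmod n, (i-j) \bmod n\} \leq k$. A biclique of a graph is a maximal (under inclusion) set of vertices inducing a complete bipartite subgraph with at least one edge. A biclique-colouring is an assignment of colours to the vertices such that no biclique is monochromatic; the biclique-chromatic number is the least $c$ such that a biclique-colouring with at most $c$ colours exists. -}

module Defs where

open import Data.Nat using (ℕ; zero; suc; _+_; _∸_; _≤_; _<_; _⊓_)
open import Data.Nat.DivMod using (_%_)
open import Data.Fin using (Fin; toℕ)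
open import Data.Fin.Subset using (Subset; _∈_; _⊆_; _∪_)
open import Data.Product using (Σ; _×_; ∃-syntax)
open import Data.Empty using (⊥)
open import Relation.Nullary using (¬_)
open import Relation.Binary.PropositionalEquality using (_≡_)

-- Vertices of C_n^k are Fin n (v_i ↦ i).  (j - i) mod n, computed in ℕ as (n + j ∸ i) % n.
-- For n = 0 there are no vertices, so the adjacency is only defined for n = suc m.
modDiff : (n : ℕ) → Fin n → Fin n → ℕ
modDiff (suc m) i j = (suc m + toℕ j ∸ toℕ i) % suc m

CycPowAdj : (n k : ℕ) → Fin n → Fin n → Set
CycPowAdj n k i j = ¬ (i ≡ j) × (modDiff n i j ⊓ modDiff n j i ≤ k)

Graph : ℕ → Set₁
Graph n = Fin n → Fin n → Set

module _ {n : ℕ} (G : Graph n) where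

  Independent : Subset n → Set
  Independent X = ∀ u v → u ∈ X → v ∈ X → ¬ G u v

  InducesCompleteBipartite : Subset n → Set
  InducesCompleteBipartite S =
    ∃[ X ] ∃[ Y ] ((X ∪ Y ≡ S)
                 × (∀ v → v ∈ X → v ∈ Y → ⊥)
                 × Independent X × Independent Y
                 × (∀ x y → x ∈ X → y ∈ Y → G x y))

  HasEdge : Subset n → Set
  HasEdge S = ∃[ u ] ∃[ v ] (u ∈ S × v ∈ S × G u v)

  BicliqueSet : Subset n → Set
  BicliqueSet S = InducesCompleteBipartite S × HasEdge S

  Biclique : Subset n → Set
  Biclique S = BicliqueSet S × (∀ T → S ⊆ T → BicliqueSet T → T ⊆ S)

  Monochromatic : {c : ℕ} → (Fin n → Fin c) → Subset n → Set
  Monochromatic col S = ∀ u v → u ∈ S → v ∈ S → col u ≡ col v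

  IsBicliqueColouring : {c : ℕ} → (Fin n → Fin c) → Set
  IsBicliqueColouring col = ∀ S → Biclique S → ¬ Monochromatic col S

  BicliqueColourable : ℕ → Set
  BicliqueColourable c = Σ (Fin n → Fin c) IsBicliqueColouring

  BicliqueChromaticNumber≡ : ℕ → Set
  BicliqueChromaticNumber≡ c = BicliqueColourable c × (∀ d → d < c → ¬ BicliqueColourable d)

module Submission where

-- Colour v_0, …, v_{k−1} with one colour and v_k, …, v_{n−1} with the other.  The first class is a
-- clique, so a biclique inside it is a single edge v_p v_q (p < q), and v_{p+k+1} is adjacent to v_q
-- but not to v_p, so the edge is not maximal.  The second class induces a power of a path, in which
-- a complete bipartite subgraph has no 4-cycle and hence is a single edge or a star with one leaf on
-- each side of its centre.  A vertex w < k misses exactly the vertices strictly between w + k and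
-- w + n − k, an interval of n − 2k − 1 ≤ k vertices; it can be slid to separate one end of the edge
-- from the other, or the centre of the star from both leaves, again contradicting maximality.
-- Fewer than two colours never suffice, since every edge lies in some biclique.

open import Defs
open import Data.Nat using (ℕ; zero; suc; _+_; _*_; _∸_; _≤_; _<_; _≤?_; _<?_; z≤n; s≤s; z<s)
open import Data.Nat.DivMod using (_%_; [m+n]%n≡m%n; m<n⇒m%n≡m)
open import Data.Nat.Properties
open import Data.Nat.Tactic.RingSolver using (solve)
open import Data.List using (_∷_; [])
open import Data.Fin using (Fin; toℕ; fromℕ<)
open import Data.Fin.Properties using (toℕ-fromℕ<; toℕ<n; any?) renaming (<-cmp to <-cmpᶠ)
open import Data.Fin.Subset using (Subset; _∈_; _∉_; _⊆_; _∪_; ⁅_⁆; ∣_∣)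
open import Data.Fin.Subset.Properties
  using (_∈?_; x∈p∪q⁻; x∈p∪q⁺; x∈⁅x⁆; x∈⁅y⁆⇒x≡y; ∪-comm; p⊂q⇒∣p∣<∣q∣; ∣p∣≤n)
open import Data.Product using (∃-syntax; _×_; _,_)
open import Data.Sum using (_⊎_; inj₁; inj₂; swap)
open import Data.Empty using (⊥; ⊥-elim)
open import Relation.Nullary using (¬_; Dec; yes; no; contradiction)
open import Relation.Nullary.Decidable using (_×-dec_)
open import Function using (case_of_)
open import Relation.Binary using (Symmetric; tri<; tri≈; tri>)
open import Relation.Binary.PropositionalEquality using (_≡_; refl; sym; trans; cong; subst; module ≡-Reasoning)

-- L ≤ R follows from A ≤ B when L + B = R + A; the identity is left to the ring solver.
linear-≤ : ∀ {L R A B : ℕ} → A ≤ B → L + B ≡ R + A → L ≤ R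
linear-≤ {L} {R} {A} {B} A≤B eq =
  +-cancelʳ-≤ B L R (subst (_≤ R + B) (sym eq) (+-monoʳ-≤ R A≤B))

linear-⊥ : ∀ {A B : ℕ} c → A ≤ B → suc c + B ≡ A → ⊥
linear-⊥ c A≤B eq with linear-≤ {suc c} {0} A≤B eq
... | ()

module Bicliques {n : ℕ} (G : Graph n) (G-sym : Symmetric G) (G-irrefl : ∀ v → ¬ G v v) where

  CompleteBipartition : Subset n → Subset n → Subset n → Set
  CompleteBipartition S X Y =
    (X ∪ Y ≡ S) × (∀ v → v ∈ X → v ∈ Y → ⊥) × Independent G X × Independent G Y
    × (∀ x y → x ∈ X → y ∈ Y → G x y)

  Maximal : Subset n → Set
  Maximal S = ∀ T → S ⊆ T → BicliqueSet G T → T ⊆ S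

  Distinguishes : Fin n → Fin n → Fin n → Set
  Distinguishes w x y = (G w x × ¬ G w y) ⊎ (G w y × ¬ G w x)

  swap-parts : ∀ {S X Y} → CompleteBipartition S X Y → CompleteBipartition S Y X
  swap-parts {X = X} {Y} (X∪Y≡S , disjoint , X-indep , Y-indep , across) =
    trans (∪-comm Y X) X∪Y≡S , (λ v v∈Y v∈X → disjoint v v∈X v∈Y) , Y-indep , X-indep ,
    λ y x y∈Y x∈X → G-sym (across x y x∈X y∈Y)

  left⊆ : ∀ {S X Y} → CompleteBipartition S X Y → X ⊆ S
  left⊆ (refl , _) x∈X = x∈p∪q⁺ (inj₁ x∈X)

  right⊆ : ∀ {S X Y} → CompleteBipartition S X Y → Y ⊆ S
  right⊆ (refl , _) y∈Y = x∈p∪q⁺ (inj₂ y∈Y)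

  ∈-parts : ∀ {S X Y} → CompleteBipartition S X Y → ∀ {z} → z ∈ S → z ∈ X ⊎ z ∈ Y
  ∈-parts {X = X} {Y} (refl , _) = x∈p∪q⁻ X Y

  edge-across : ∀ {S X Y} → CompleteBipartition S X Y → HasEdge G S → ∃[ x ] ∃[ y ] (x ∈ X × y ∈ Y)
  edge-across d@(_ , _ , X-indep , Y-indep , _) (u , v , u∈S , v∈S , uv)
    with ∈-parts d u∈S | ∈-parts d v∈S
  ... | inj₁ u∈X | inj₁ v∈X = ⊥-elim (X-indep u v u∈X v∈X uv)
  ... | inj₁ u∈X | inj₂ v∈Y = u , v , u∈X , v∈Y
  ... | inj₂ u∈Y | inj₁ v∈X = v , u , v∈X , u∈Y
  ... | inj₂ u∈Y | inj₂ v∈Y = ⊥-elim (Y-indep u v u∈Y v∈Y uv)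

  maximal-absorbs : ∀ {S X Y} → CompleteBipartition S X Y → HasEdge G S → Maximal S → ∀ w →
                    (∀ x → x ∈ X → ¬ G w x) → (∀ y → y ∈ Y → G w y) → w ∈ S
  maximal-absorbs {X = X} {Y} (refl , disjoint , X-indep , Y-indep , across) (u , v , u∈S , v∈S , uv)
                  maximal w w≁X w~Y =
    maximal T S⊆T ((X′ , Y , refl , disjoint′ , X′-indep , Y-indep , across′) ,
                   (u , v , S⊆T u∈S , S⊆T v∈S , uv))
            (x∈p∪q⁺ (inj₁ (x∈p∪q⁺ (inj₂ (x∈⁅x⁆ w)))))
    where
    X′ = X ∪ ⁅ w ⁆
    T = X′ ∪ Y

    S⊆T : X ∪ Y ⊆ T
    S⊆T z∈S with x∈p∪q⁻ X Y z∈S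
    ... | inj₁ z∈X = x∈p∪q⁺ (inj₁ (x∈p∪q⁺ (inj₁ z∈X)))
    ... | inj₂ z∈Y = x∈p∪q⁺ (inj₂ z∈Y)

    ∈X′ : ∀ {z} → z ∈ X′ → z ∈ X ⊎ z ≡ w
    ∈X′ z∈X′ with x∈p∪q⁻ X ⁅ w ⁆ z∈X′
    ... | inj₁ z∈X = inj₁ z∈X
    ... | inj₂ z∈w = inj₂ (x∈⁅y⁆⇒x≡y w z∈w)

    disjoint′ : ∀ z → z ∈ X′ → z ∈ Y → ⊥
    disjoint′ z z∈X′ z∈Y with ∈X′ z∈X′
    ... | inj₁ z∈X = disjoint z z∈X z∈Y
    ... | inj₂ refl = G-irrefl z (w~Y z z∈Y)

    X′-indep : Independent G X′
    X′-indep a b a∈X′ b∈X′ with ∈X′ a∈X′ | ∈X′ b∈X′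
    ... | inj₁ a∈X | inj₁ b∈X = X-indep a b a∈X b∈X
    ... | inj₁ a∈X | inj₂ refl = λ ab → w≁X a a∈X (G-sym ab)
    ... | inj₂ refl | inj₁ b∈X = w≁X b b∈X
    ... | inj₂ refl | inj₂ refl = G-irrefl a

    across′ : ∀ x y → x ∈ X′ → y ∈ Y → G x y
    across′ x y x∈X′ y∈Y with ∈X′ x∈X′
    ... | inj₁ x∈X = across x y x∈X y∈Y
    ... | inj₂ refl = w~Y y y∈Y

  singleton-parts-absorb : ∀ {S X Y} → CompleteBipartition S X Y → HasEdge G S → Maximal S → ∀ {x y w} →
                           (∀ z → z ∈ X → z ≡ x) → (∀ z → z ∈ Y → z ≡ y) →
                           Distinguishes w x y → w ∈ S
  singleton-parts-absorb d e maximal X≡x Y≡y (inj₁ (w~x , w≁y)) =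
    maximal-absorbs (swap-parts d) e maximal _
      (λ z z∈Y → subst (λ t → ¬ G _ t) (sym (Y≡y z z∈Y)) w≁y)
      (λ z z∈X → subst (G _) (sym (X≡x z z∈X)) w~x)
  singleton-parts-absorb d e maximal X≡x Y≡y (inj₂ (w~y , w≁x)) =
    maximal-absorbs d e maximal _
      (λ z z∈X → subst (λ t → ¬ G _ t) (sym (X≡x z z∈X)) w≁x)
      (λ z z∈Y → subst (G _) (sym (Y≡y z z∈Y)) w~y)

  singleton-parts-impossible :
    ∀ {S X Y x y} → CompleteBipartition S X Y → HasEdge G S → Maximal S → x ∈ X → y ∈ Y →
    (∀ z → z ∈ X → z ≡ x) → (∀ z → z ∈ Y → z ≡ y) →
    (∀ {p q} → p ∈ S → q ∈ S → toℕ p < toℕ q → G p q → ∃[ w ] (w ∉ S × Distinguishes w p q)) → ⊥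
  singleton-parts-impossible {x = x} {y} d@(_ , _ , _ , _ , across) e maximal x∈X y∈Y X≡x Y≡y distinguished
    with <-cmpᶠ x y
  ... | tri< x<y _ _ with distinguished (left⊆ d x∈X) (right⊆ d y∈Y) x<y (across x y x∈X y∈Y)
  ...   | w , w∉S , w-dist = w∉S (singleton-parts-absorb d e maximal X≡x Y≡y w-dist)
  singleton-parts-impossible {x = x} {y} (_ , disjoint , _) _ _ x∈X y∈Y _ _ _ | tri≈ _ refl _ =
    disjoint x x∈X y∈Y
  singleton-parts-impossible {x = x} {y} d@(_ , _ , _ , _ , across) e maximal x∈X y∈Y X≡x Y≡y distinguished
    | tri> _ _ y<x with distinguished (right⊆ d y∈Y) (left⊆ d x∈X) y<x (G-sym (across x y x∈X y∈Y))
  ...   | w , w∉S , w-dist = w∉S (singleton-parts-absorb d e maximal X≡x Y≡y (swap w-dist))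

  maximal-unless-growable : ∀ {S} → (∀ T → S ⊆ T → ∣ S ∣ < ∣ T ∣ → ¬ BicliqueSet G T) → Maximal S
  maximal-unless-growable {S} no-larger T S⊆T T-biclique {z} z∈T with z ∈? S
  ... | yes z∈S = z∈S
  ... | no z∉S = ⊥-elim (no-larger T S⊆T (p⊂q⇒∣p∣<∣q∣ (S⊆T , z , z∈T , z∉S)) T-biclique)

  -- Induction on the room n − ∣S∣ left for growing S.
  bicliqueSet⇒¬¬biclique : ∀ {S} → BicliqueSet G S → ¬ (∀ T → ¬ Biclique G T)
  bicliqueSet⇒¬¬biclique {S} S-biclique none = grow n S (m≤n+m n ∣ S ∣) S-biclique
    where
    grow : ∀ r S → n ≤ ∣ S ∣ + r → ¬ BicliqueSet G S
    grow zero S n≤∣S∣ S-biclique = none S (S-biclique , maximal-unless-growable λ T _ ∣S∣<∣T∣ _ →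
      <⇒≱ ∣S∣<∣T∣ (≤-trans (∣p∣≤n T) (subst (n ≤_) (+-identityʳ ∣ S ∣) n≤∣S∣)))
    grow (suc r) S n≤∣S∣+1+r S-biclique = none S (S-biclique , maximal-unless-growable λ T _ ∣S∣<∣T∣ →
      grow r T (≤-trans n≤∣S∣+1+r (subst (_≤ ∣ T ∣ + r) (sym (+-suc ∣ S ∣ r)) (+-monoˡ-≤ r ∣S∣<∣T∣))))

  edge-bicliqueSet : ∀ {u v} → G u v → BicliqueSet G (⁅ u ⁆ ∪ ⁅ v ⁆)
  edge-bicliqueSet {u} {v} uv =
    (⁅ u ⁆ , ⁅ v ⁆ , refl , disjoint , singleton-indep u , singleton-indep v , across) ,
    (u , v , x∈p∪q⁺ (inj₁ (x∈⁅x⁆ u)) , x∈p∪q⁺ (inj₂ (x∈⁅x⁆ v)) , uv)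
    where
    singleton-indep : ∀ x → Independent G ⁅ x ⁆
    singleton-indep x a b a∈x b∈x with x∈⁅y⁆⇒x≡y x a∈x | x∈⁅y⁆⇒x≡y x b∈x
    ... | refl | refl = G-irrefl x

    disjoint : ∀ z → z ∈ ⁅ u ⁆ → z ∈ ⁅ v ⁆ → ⊥
    disjoint z z∈u z∈v with x∈⁅y⁆⇒x≡y u z∈u | x∈⁅y⁆⇒x≡y v z∈v
    ... | refl | refl = G-irrefl z uv

    across : ∀ x y → x ∈ ⁅ u ⁆ → y ∈ ⁅ v ⁆ → G x y
    across x y x∈u y∈v with x∈⁅y⁆⇒x≡y u x∈u | x∈⁅y⁆⇒x≡y v y∈v
    ... | refl | refl = uv

  edge⇒¬colourable-below-2 : ∀ {u v} → G u v → ∀ c → c < 2 → ¬ BicliqueColourable G c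
  edge⇒¬colourable-below-2 {u} uv zero _ (colour , _) with colour u
  ... | ()
  edge⇒¬colourable-below-2 uv (suc zero) _ (colour , colouring) =
    bicliqueSet⇒¬¬biclique (edge-bicliqueSet uv) λ T T-biclique →
      colouring T T-biclique λ x y _ _ → Fin1-≡ (colour x) (colour y)
    where
    Fin1-≡ : (i j : Fin 1) → i ≡ j
    Fin1-≡ Fin.zero Fin.zero = refl
  edge⇒¬colourable-below-2 uv (suc (suc _)) (s≤s (s≤s ()))

HasTwo : ∀ {n} → Subset n → Set
HasTwo X = ∃[ u ] ∃[ v ] (u ∈ X × v ∈ X × toℕ u < toℕ v)

hasTwo? : ∀ {n} (X : Subset n) → Dec (HasTwo X)
hasTwo? X = any? λ u → any? λ v → u ∈? X ×-dec v ∈? X ×-dec toℕ u <? toℕ v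

¬HasTwo⇒≡ : ∀ {n} {X : Subset n} {x} → x ∈ X → ¬ HasTwo X → ∀ z → z ∈ X → z ≡ x
¬HasTwo⇒≡ {x = x} x∈X one z z∈X with <-cmpᶠ z x
... | tri< z<x _ _ = ⊥-elim (one (z , x , z∈X , x∈X , z<x))
... | tri≈ _ z≡x _ = z≡x
... | tri> _ _ x<z = ⊥-elim (one (x , z , x∈X , z∈X , x<z))

CycPowAdj-sym : ∀ {n k} → Symmetric (CycPowAdj n k)
CycPowAdj-sym {n} {k} {i} {j} (i≢j , close) =
  (λ j≡i → i≢j (sym j≡i)) , subst (_≤ k) (⊓-comm (modDiff n i j) (modDiff n j i)) close

CycPowAdj-irrefl : ∀ {n k} v → ¬ CycPowAdj n k v v
CycPowAdj-irrefl v (v≢v , _) = v≢v refl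

module Gap (k N : ℕ) where

  -- b lies more than k steps from a in both directions around a cycle of length N, with b after a.
  InGap : ℕ → ℕ → Set
  InGap a b = k + a < b × k + b < N + a

  module Witnesses (2k+2≤N : 2 * k + 2 ≤ N) (N≤3k+1 : N ≤ 3 * k + 1) where

    k<N : k < N
    k<N = linear-≤ (+-mono-≤ 2k+2≤N (z≤n {suc k})) (solve (k ∷ N ∷ []))

    gap-between : ∀ {a b c} → k ≤ a → a < c → c < b → k + a < b → b < N →
                  ∃[ w ] (w < k × a ≤ k + w × InGap w c × N + w ≤ k + b)
    gap-between {b = b} {c} k≤a a<c c<b k+a<b b<N with m≤n⇒∃[o]m+o≡n k≤a
    ... | a′ , refl with k + c <? N + a′
    ...   | yes k+c<N+a′ =
            a′ , linear-≤ (+-mono-≤ k+a<b (+-mono-≤ b<N N≤3k+1)) (solve (a′ ∷ b ∷ k ∷ N ∷ [])) ,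
            ≤-refl , (a<c , k+c<N+a′) , linear-≤ (+-mono-≤ k+a<b N≤3k+1) (solve (a′ ∷ b ∷ k ∷ N ∷ []))
    ...   | no k+c≮N+a′ with m≤n⇒∃[o]m+o≡n (≤-trans (m≤m+n N a′) (m≤n⇒m≤1+n (≮⇒≥ k+c≮N+a′)))
    ...     | w , N+w≡ =
            w , linear-≤ (+-mono-≤ (≤-reflexive N+w≡) (+-mono-≤ c<b b<N)) (solve (w ∷ b ∷ c ∷ k ∷ N ∷ [])) ,
            <⇒≤ (linear-≤ (+-mono-≤ (≮⇒≥ k+c≮N+a′) (≤-reflexive (sym N+w≡)))
                          (solve (a′ ∷ w ∷ c ∷ k ∷ N ∷ []))) ,
            (linear-≤ (+-mono-≤ (≤-reflexive N+w≡) 2k+2≤N) (solve (w ∷ c ∷ k ∷ N ∷ [])) ,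
             ≤-reflexive (sym N+w≡)) ,
            subst (_≤ k + b) (sym N+w≡) (+-monoʳ-< k c<b)

    gap-ending-at : ∀ {p q} → p < q → q < N → N ≤ suc (k + p) →
                    ∃[ w ] (w < k × InGap w p × N + w ≤ k + q)
    gap-ending-at {p} {q} p<q q<N N≤1+k+p with m≤n⇒∃[o]m+o≡n N≤1+k+p
    ... | w , N+w≡ =
      w , linear-≤ (+-mono-≤ (≤-reflexive N+w≡) (+-mono-≤ p<q q<N)) (solve (w ∷ p ∷ q ∷ k ∷ N ∷ [])) ,
      (linear-≤ (+-mono-≤ (≤-reflexive N+w≡) 2k+2≤N) (solve (w ∷ p ∷ k ∷ N ∷ [])) ,
       ≤-reflexive (sym N+w≡)) ,
      subst (_≤ k + q) (sym N+w≡) (+-monoʳ-< k p<q)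

    beyond-reach : ∀ {p q} → p < q → q < k →
                   ∃[ w ] (w < N × k ≤ w × q < w × w ≤ k + q × InGap p w)
    beyond-reach {p} {q} p<q q<k =
      suc (k + p) ,
      linear-≤ (+-mono-≤ (+-mono-≤ (<-trans p<q q<k) 2k+2≤N) (z≤n {1})) (solve (p ∷ k ∷ N ∷ [])) ,
      m≤n⇒m≤1+n (m≤m+n k p) , s≤s (≤-trans (<⇒≤ q<k) (m≤m+n k p)) , +-monoʳ-< k p<q ,
      ≤-refl , linear-≤ 2k+2≤N (solve (p ∷ k ∷ N ∷ []))

module CyclePower (k m : ℕ) where

  N : ℕ
  N = suc m

  open Gap k N using (InGap)

  _~_ : Fin N → Fin N → Set
  _~_ = CycPowAdj N k

  modDiff-≤ : ∀ {i j} → toℕ i ≤ toℕ j → modDiff N i j + toℕ i ≡ toℕ j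
  modDiff-≤ {i} {j} i≤j = begin
    (N + b ∸ a) % N + a    ≡⟨ cong (λ t → t % N + a) (+-∸-assoc N i≤j) ⟩
    (N + (b ∸ a)) % N + a  ≡⟨ cong (λ t → t % N + a) (+-comm N (b ∸ a)) ⟩
    (b ∸ a + N) % N + a    ≡⟨ cong (_+ a) ([m+n]%n≡m%n (b ∸ a) N) ⟩
    (b ∸ a) % N + a        ≡⟨ cong (_+ a) (m<n⇒m%n≡m (≤-<-trans (m∸n≤m b a) (toℕ<n j))) ⟩
    b ∸ a + a              ≡⟨ m∸n+n≡m i≤j ⟩
    b                      ∎
    where
    open ≡-Reasoning
    a = toℕ i
    b = toℕ j

  modDiff-> : ∀ {i j} → toℕ j < toℕ i → modDiff N i j + toℕ i ≡ N + toℕ j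
  modDiff-> {i} {j} j<i = begin
    (N + b ∸ a) % N + a  ≡⟨ cong (_+ a) (m<n⇒m%n≡m (+-cancelʳ-< a (N + b ∸ a) N below)) ⟩
    N + b ∸ a + a        ≡⟨ back ⟩
    N + b                ∎
    where
    open ≡-Reasoning
    a = toℕ i
    b = toℕ j
    back : N + b ∸ a + a ≡ N + b
    back = m∸n+n≡m (≤-trans (<⇒≤ (toℕ<n i)) (m≤m+n N b))
    below : N + b ∸ a + a < N + a
    below = subst (_< N + a) (sym back) (+-monoʳ-< N j<i)

  ~-near : ∀ {i j} → toℕ i < toℕ j → toℕ j ≤ k + toℕ i → i ~ j
  ~-near {i} {j} i<j j≤k+i =
    (λ { refl → <-irrefl refl i<j }) ,
    ≤-trans (m⊓n≤m _ _) (+-cancelʳ-≤ (toℕ i) _ k (subst (_≤ k + toℕ i) (sym (modDiff-≤ (<⇒≤ i<j))) j≤k+i))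

  ~-wrap : ∀ {i j} → toℕ i < toℕ j → N + toℕ i ≤ k + toℕ j → i ~ j
  ~-wrap {i} {j} i<j N+i≤k+j =
    (λ { refl → <-irrefl refl i<j }) ,
    ≤-trans (m⊓n≤n _ _) (+-cancelʳ-≤ (toℕ j) _ k (subst (_≤ k + toℕ j) (sym (modDiff-> i<j)) N+i≤k+j))

  ~⇒near⊎wrap : ∀ {i j} → toℕ i < toℕ j → i ~ j → toℕ j ≤ k + toℕ i ⊎ N + toℕ i ≤ k + toℕ j
  ~⇒near⊎wrap {i} {j} i<j (_ , close) with ⊓-sel (modDiff N i j) (modDiff N j i)
  ... | inj₁ ⊓≡ij =
    inj₁ (subst (_≤ k + toℕ i) (modDiff-≤ (<⇒≤ i<j)) (+-monoˡ-≤ (toℕ i) (subst (_≤ k) ⊓≡ij close)))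
  ... | inj₂ ⊓≡ji =
    inj₂ (subst (_≤ k + toℕ j) (modDiff-> i<j) (+-monoˡ-≤ (toℕ j) (subst (_≤ k) ⊓≡ji close)))

  ≁-gap : ∀ {i j} → InGap (toℕ i) (toℕ j) → ¬ i ~ j
  ≁-gap {i} {j} (k+i<j , k+j<N+i) i~j with ~⇒near⊎wrap (≤-<-trans (m≤n+m (toℕ i) k) k+i<j) i~j
  ... | inj₁ near = <⇒≱ k+i<j near
  ... | inj₂ wrap = <⇒≱ k+j<N+i wrap

  high-~⇒≤k+ : ∀ {i j} → k ≤ toℕ i → i ~ j → toℕ j ≤ k + toℕ i
  high-~⇒≤k+ {i} {j} k≤i i~j with <-cmpᶠ i j
  ... | tri< i<j _ _ with ~⇒near⊎wrap i<j i~j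
  ...   | inj₁ near = near
  ...   | inj₂ wrap = contradiction wrap (<⇒≱ (begin-strict
          k + toℕ j  <⟨ +-monoʳ-< k (toℕ<n j) ⟩
          k + N      ≡⟨ +-comm k N ⟩
          N + k      ≤⟨ +-monoʳ-≤ N k≤i ⟩
          N + toℕ i  ∎))
    where open ≤-Reasoning
  high-~⇒≤k+ {i} {j} k≤i i~j | tri≈ _ refl _ = m≤n+m (toℕ i) k
  high-~⇒≤k+ {i} {j} k≤i i~j | tri> _ _ j<i = ≤-trans (<⇒≤ j<i) (m≤n+m (toℕ i) k)

  independent-far : ∀ {I u v} → Independent _~_ I → u ∈ I → v ∈ I → toℕ u < toℕ v → k + toℕ u < toℕ v
  independent-far {u = u} {v} I-indep u∈I v∈I u<v = ≰⇒> λ v≤k+u → I-indep u v u∈I v∈I (~-near u<v v≤k+u)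

  independent-close⇒≡ : ∀ {I u v} → Independent _~_ I → u ∈ I → v ∈ I →
                        toℕ u ≤ k + toℕ v → toℕ v ≤ k + toℕ u → u ≡ v
  independent-close⇒≡ {u = u} {v} I-indep u∈I v∈I u≤k+v v≤k+u with <-cmpᶠ u v
  ... | tri< u<v _ _ = contradiction v≤k+u (<⇒≱ (independent-far I-indep u∈I v∈I u<v))
  ... | tri≈ _ u≡v _ = u≡v
  ... | tri> _ _ v<u = contradiction u≤k+v (<⇒≱ (independent-far I-indep v∈I u∈I v<u))

module Colouring (k m : ℕ) (2k+2≤N : 2 * k + 2 ≤ suc m) (N≤3k+1 : suc m ≤ 3 * k + 1) where

  open CyclePower k m
  open Gap k N using (InGap)
  open Gap.Witnesses k N 2k+2≤N N≤3k+1
  open Bicliques _~_ CycPowAdj-sym CycPowAdj-irrefl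

  vertex : ∀ {a} → a < N → ∃[ v ] (toℕ v ≡ a)
  vertex a<N = fromℕ< a<N , toℕ-fromℕ< a<N

  colour : Fin N → Fin 2
  colour v with toℕ v <? k
  ... | yes _ = Fin.zero
  ... | no _  = Fin.suc Fin.zero

  same-colour-low : ∀ {u v} → colour u ≡ colour v → toℕ u < k → toℕ v < k
  same-colour-low {u} {v} eq u<k with toℕ u <? k | toℕ v <? k
  ... | _       | yes v<k = v<k
  ... | yes _   | no _    = case eq of λ ()
  ... | no u≮k  | no _    = contradiction u<k u≮k

  same-colour-high : ∀ {u v} → colour u ≡ colour v → k ≤ toℕ u → k ≤ toℕ v
  same-colour-high {u} {v} eq k≤u with toℕ u <? k | toℕ v <? k
  ... | _       | no v≮k  = ≮⇒≥ v≮k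
  ... | no _    | yes _   = case eq of λ ()
  ... | yes u<k | yes _   = contradiction k≤u (<⇒≱ u<k)

  monochromatic⇒one-sided : ∀ {S x} → x ∈ S → Monochromatic _~_ colour S →
                            (∀ z → z ∈ S → toℕ z < k) ⊎ (∀ z → z ∈ S → k ≤ toℕ z)
  monochromatic⇒one-sided {x = x} x∈S mono with toℕ x <? k
  ... | yes x<k = inj₁ λ z z∈S → same-colour-low (mono x z x∈S z∈S) x<k
  ... | no x≮k  = inj₂ λ z z∈S → same-colour-high (mono x z x∈S z∈S) (≮⇒≥ x≮k)

  low-edge-distinguished : ∀ {p q} → toℕ p < toℕ q → toℕ q < k → ∃[ w ] (k ≤ toℕ w × Distinguishes w p q)
  low-edge-distinguished p<q q<k with beyond-reach p<q q<k
  ... | i , i<N , k≤i , q<i , i≤k+q , p-gap with vertex i<N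
  ...   | w , refl = w , k≤i , inj₂ (CycPowAdj-sym (~-near q<i i≤k+q) , λ w~p → ≁-gap p-gap (CycPowAdj-sym w~p))

  high-edge-distinguished : ∀ {p q} → k ≤ toℕ p → toℕ p < toℕ q → p ~ q →
                            ∃[ w ] (toℕ w < k × Distinguishes w p q)
  high-edge-distinguished {p} {q} k≤p p<q p~q with N ≤? suc (k + toℕ p)
  ... | yes N≤1+k+p with gap-ending-at p<q (toℕ<n q) N≤1+k+p
  ...   | i , i<k , p-gap , N+i≤k+q with vertex (<-trans i<k k<N)
  ...     | w , refl = w , i<k , inj₂ (~-wrap (<-trans (<-≤-trans i<k k≤p) p<q) N+i≤k+q , ≁-gap p-gap)
  high-edge-distinguished {p} {q} k≤p p<q p~q | no N≰1+k+p
    with gap-between k≤p p<q (s≤s (high-~⇒≤k+ k≤p p~q)) ≤-refl (≰⇒> N≰1+k+p)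
  ...   | i , i<k , p≤k+i , q-gap , _ with vertex (<-trans i<k k<N)
  ...     | w , refl = w , i<k , inj₁ (~-near (<-≤-trans i<k k≤p) p≤k+i , ≁-gap q-gap)

  low-case : ∀ {S X Y} → CompleteBipartition S X Y → HasEdge _~_ S → Maximal S →
             (∀ z → z ∈ S → toℕ z < k) → ⊥
  low-case {S} d@(_ , _ , X-indep , Y-indep , _) e maximal low with edge-across d e
  ... | x , y , x∈X , y∈Y =
    singleton-parts-impossible d e maximal x∈X y∈Y
      (λ z z∈X → low-independent-≡ X-indep (left⊆ d) z∈X x∈X)
      (λ z z∈Y → low-independent-≡ Y-indep (right⊆ d) z∈Y y∈Y)
      distinguished
    where
    low-independent-≡ : ∀ {I u v} → Independent _~_ I → I ⊆ S → u ∈ I → v ∈ I → u ≡ v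
    low-independent-≡ {u = u} {v} I-indep I⊆S u∈I v∈I =
      independent-close⇒≡ I-indep u∈I v∈I
        (≤-trans (<⇒≤ (low u (I⊆S u∈I))) (m≤m+n k (toℕ v)))
        (≤-trans (<⇒≤ (low v (I⊆S v∈I))) (m≤m+n k (toℕ u)))

    distinguished : ∀ {p q} → p ∈ S → q ∈ S → toℕ p < toℕ q → p ~ q →
                    ∃[ w ] (w ∉ S × Distinguishes w p q)
    distinguished p∈S q∈S p<q _ with low-edge-distinguished p<q (low _ q∈S)
    ... | w , k≤w , w-dist = w , (λ w∈S → <⇒≱ (low w w∈S) k≤w) , w-dist

  no-C4 : ∀ {S X Y} → CompleteBipartition S X Y → (∀ z → z ∈ S → k ≤ toℕ z) → HasTwo X → HasTwo Y → ⊥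
  no-C4 d@(_ , _ , X-indep , Y-indep , across) high
        (a₁ , a₂ , a₁∈X , a₂∈X , a₁<a₂) (b₁ , b₂ , b₁∈Y , b₂∈Y , b₁<b₂) =
    crossing (independent-far X-indep a₁∈X a₂∈X a₁<a₂) (independent-far Y-indep b₁∈Y b₂∈Y b₁<b₂)
      (high-~⇒≤k+ (high b₁ (right⊆ d b₁∈Y)) (CycPowAdj-sym (across a₂ b₁ a₂∈X b₁∈Y)))
      (high-~⇒≤k+ (high a₁ (left⊆ d a₁∈X)) (across a₁ b₂ a₁∈X b₂∈Y))
    where
    crossing : ∀ {a₁ a₂ b₁ b₂} → k + a₁ < a₂ → k + b₁ < b₂ → a₂ ≤ k + b₁ → b₂ ≤ k + a₁ → ⊥
    crossing {a₁} {a₂} {b₁} {b₂} p q r s =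
      linear-⊥ 1 (+-mono-≤ (+-mono-≤ p q) (+-mono-≤ r s)) (solve (a₁ ∷ a₂ ∷ b₁ ∷ b₂ ∷ k ∷ []))

  -- The two leaves u < c < v lie on both sides of the centre c, and a vertex of [0, k) sees both but not c.
  star-two-leaves : ∀ {S X Y c} → CompleteBipartition S X Y → HasEdge _~_ S → Maximal S →
                    (∀ z → z ∈ S → k ≤ toℕ z) → c ∈ X → (∀ z → z ∈ X → z ≡ c) → HasTwo Y → ⊥
  star-two-leaves {X = X} {Y} {c} d@(_ , disjoint , _ , Y-indep , across) e maximal high c∈X X≡c
                  (u , v , u∈Y , v∈Y , u<v) =
    absorbed (gap-between (high u (right⊆ d u∈Y)) u<c c<v k+u<v (toℕ<n v))
    where
    ≤k+c : ∀ {z} → z ∈ Y → toℕ z ≤ k + toℕ c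
    ≤k+c z∈Y = high-~⇒≤k+ (high c (left⊆ d c∈X)) (across c _ c∈X z∈Y)

    c≤k+ : ∀ {z} → z ∈ Y → toℕ c ≤ k + toℕ z
    c≤k+ z∈Y = high-~⇒≤k+ (high _ (right⊆ d z∈Y)) (CycPowAdj-sym (across c _ c∈X z∈Y))

    k+u<v : k + toℕ u < toℕ v
    k+u<v = independent-far Y-indep u∈Y v∈Y u<v

    u<c : toℕ u < toℕ c
    u<c = +-cancelˡ-< k (toℕ u) (toℕ c) (<-≤-trans k+u<v (≤k+c v∈Y))

    c<v : toℕ c < toℕ v
    c<v = ≤-<-trans (c≤k+ u∈Y) k+u<v

    Y≡u⊎v : ∀ z → z ∈ Y → z ≡ u ⊎ z ≡ v
    Y≡u⊎v z z∈Y with <-cmpᶠ z c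
    ... | tri< z<c _ _ = inj₁ (independent-close⇒≡ Y-indep z∈Y u∈Y
                                (<⇒≤ (<-≤-trans z<c (c≤k+ u∈Y))) (<⇒≤ (<-≤-trans u<c (c≤k+ z∈Y))))
    ... | tri≈ _ refl _ = ⊥-elim (disjoint z c∈X z∈Y)
    ... | tri> _ _ c<z = inj₂ (independent-close⇒≡ Y-indep z∈Y v∈Y
                                (≤-trans (≤k+c z∈Y) (+-monoʳ-≤ k (<⇒≤ c<v)))
                                (≤-trans (≤k+c v∈Y) (+-monoʳ-≤ k (<⇒≤ c<z))))

    absorbed : ∃[ i ] (i < k × toℕ u ≤ k + i × InGap i (toℕ c) × N + i ≤ k + toℕ v) → ⊥
    absorbed (i , i<k , u≤k+i , c-gap , N+i≤k+v) with vertex (<-trans i<k k<N)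
    ... | w , refl = <⇒≱ i<k (high w (maximal-absorbs d e maximal w w≁X w~Y))
      where
      w<u : toℕ w < toℕ u
      w<u = <-≤-trans i<k (high u (right⊆ d u∈Y))

      w≁X : ∀ z → z ∈ X → ¬ w ~ z
      w≁X z z∈X rewrite X≡c z z∈X = ≁-gap c-gap

      w~Y : ∀ z → z ∈ Y → w ~ z
      w~Y z z∈Y with Y≡u⊎v z z∈Y
      ... | inj₁ refl = ~-near w<u u≤k+i
      ... | inj₂ refl = ~-wrap (<-trans w<u u<v) N+i≤k+v

  high-case : ∀ {S X Y} → CompleteBipartition S X Y → HasEdge _~_ S → Maximal S →
              (∀ z → z ∈ S → k ≤ toℕ z) → ⊥
  high-case {S} {X} {Y} d e maximal high with edge-across d e
  ... | x , y , x∈X , y∈Y with hasTwo? X | hasTwo? Y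
  ...   | yes two-X | yes two-Y = no-C4 d high two-X two-Y
  ...   | yes two-X | no one-Y  = star-two-leaves (swap-parts d) e maximal high y∈Y (¬HasTwo⇒≡ y∈Y one-Y) two-X
  ...   | no one-X  | yes two-Y = star-two-leaves d e maximal high x∈X (¬HasTwo⇒≡ x∈X one-X) two-Y
  ...   | no one-X  | no one-Y  =
    singleton-parts-impossible d e maximal x∈X y∈Y (¬HasTwo⇒≡ x∈X one-X) (¬HasTwo⇒≡ y∈Y one-Y) distinguished
    where
    distinguished : ∀ {p q} → p ∈ S → q ∈ S → toℕ p < toℕ q → p ~ q →
                    ∃[ w ] (w ∉ S × Distinguishes w p q)
    distinguished p∈S _ p<q p~q with high-edge-distinguished (high _ p∈S) p<q p~q
    ... | w , w<k , w-dist = w , (λ w∈S → <⇒≱ w<k (high w w∈S)) , w-dist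

  colour-is-bicliqueColouring : IsBicliqueColouring _~_ colour
  colour-is-bicliqueColouring S (((X , Y , d) , e) , maximal) mono with edge-across d e
  ... | x , _ , x∈X , _ with monochromatic⇒one-sided (left⊆ d x∈X) mono
  ...   | inj₁ low  = low-case d e maximal low
  ...   | inj₂ high = high-case d e maximal high

theorem6 : (k n : ℕ) → 1 ≤ k → 2 * k + 2 ≤ n → n ≤ 3 * k + 1 →
    BicliqueChromaticNumber≡ (CycPowAdj n k) 2
theorem6 k zero _ 2k+2≤0 _ with ≤-trans (m≤n+m 2 (2 * k)) 2k+2≤0
... | ()
theorem6 k (suc m) 1≤k 2k+2≤N N≤3k+1 =
  (colour , colour-is-bicliqueColouring) , edge⇒¬colourable-below-2 0~1
  where
  open CyclePower k m
  open Gap.Witnesses k N 2k+2≤N N≤3k+1 using (k<N)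
  open Colouring k m 2k+2≤N N≤3k+1
  open Bicliques _~_ CycPowAdj-sym CycPowAdj-irrefl using (edge⇒¬colourable-below-2)

  1<N : 1 < N
  1<N = <-≤-trans (s≤s 1≤k) k<N

  0~1 : Fin.zero ~ fromℕ< 1<N
  0~1 = ~-near (subst (0 <_) (sym (toℕ-fromℕ< 1<N)) z<s)
               (subst (_≤ k + 0) (sym (toℕ-fromℕ< 1<N)) (≤-trans 1≤k (m≤m+n k 0)))
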